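{- Let $n$ be a positive integer, $g_1,g_2\in\mathbb{Z}$ with $\gcd(n,g_1,g_2)=1$, and let $k_1\ge k_2\ge 3$ be integers. Suppose $\{\mathrm{AP}_n(g_1,k_1),\mathrm{AP}_n(g_2,k_2)\}$ is an Erdős-deep family in $\mathbb{Z}_n$ with distance multiplicities $1,2,\dots,k-1$, and put $t:=k-k_1$. Then $n\ge (k_2-t)^2/4$.
   Context: For $x\in\mathbb{Z}_n$, $|x|_n:=\min(x,-x)$ with $\pm x$ reduced into $\{0,\dots,n-1\}$, and $\mathrm{dist}(x,y)=|x-y|_n$. For $A\subseteq\mathbb{Z}_n$, $\Delta A$ is the multiset of $\mathrm{dist}(x,y)$ over unordered pairs $\{x,y\}\subseteq A$ with $x\neq y$; for a family $\mathcal{F}$, $\Delta\mathcal{F}$ is the multiset union of $\Delta A$ over $A\in\mathcal{F}$. $\mathcal{F}$ is Erdős-deep if the multiplicities of the distinct values in $\Delta\mathcal{F}$ are exactly $1,2,\dots,k-1$ for some integer $k$. $\mathrm{AP}_n(g,k):=\{0,g,\dots,(k-1)g\}\subseteq\mathbb{Z}_n$, with its $k$ terms distinct. -}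

module Defs where

open import Data.Nat as ℕ using (ℕ; NonZero; _⊓_)
open import Data.Integer as ℤ using (ℤ; +_; _%ℕ_)
open import Data.List using (List; []; _∷_; map; upTo; _++_; length; filter; deduplicate)
open import Data.Product using (_×_; _,_; uncurry)
open import Data.List.Relation.Binary.Permutation.Propositional using (_↭_)

res : (n : ℕ) .{{_ : NonZero n}} → ℤ → ℕ
res n x = x %ℕ n

absn : (n : ℕ) .{{_ : NonZero n}} → ℤ → ℕ
absn n x = res n x ⊓ res n (ℤ.- x)

-- dist(x,y) = |x - y|_n, for x y ∈ ℤ_n given by representatives in {0,…,n-1}.
dist : (n : ℕ) .{{_ : NonZero n}} → ℕ → ℕ → ℕ
dist n x y = absn n (+ x ℤ.- + y)

AP : (n : ℕ) .{{_ : NonZero n}} → ℤ → ℕ → List ℕ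
AP n g k = map (λ i → res n (+ i ℤ.* g)) (upTo k)

pairs : {A : Set} → List A → List (A × A)
pairs [] = []
pairs (x ∷ xs) = map (x ,_) xs ++ pairs xs

-- ΔA : multiset (list) of distances over unordered pairs of (distinct) elements of A.
-- (A is given as a duplicate-free list, so position pairs = unordered pairs of distinct elements.)
Δ : (n : ℕ) .{{_ : NonZero n}} → List ℕ → List ℕ
Δ n A = map (uncurry (dist n)) (pairs A)

ΔF : (n : ℕ) .{{_ : NonZero n}} → List (List ℕ) → List ℕ
ΔF n [] = []
ΔF n (A ∷ F) = Δ n A ++ ΔF n F

mult : List ℕ → ℕ → ℕ
mult L d = length (filter (d ℕ.≟_) L)

HasDeepMultiplicities : List ℕ → ℕ → Set
HasDeepMultiplicities L k =
  map (mult L) (deduplicate ℕ._≟_ L) ↭ map ℕ.suc (upTo (k ℕ.∸ 1))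

ErdosDeepWith : (n : ℕ) .{{_ : NonZero n}} → List (List ℕ) → ℕ → Set
ErdosDeepWith n F k = HasDeepMultiplicities (ΔF n F) k

{-# OPTIONS --safe #-}
module Submission where

-- Counting pairs gives (k choose 2) = (k₁ choose 2) + (k₂ choose 2), so s := k₁ + k₂ - k = k₂ - t is
-- positive; and k ≥ k₁, since the distance |g₁|ₙ already has multiplicity k₁ - 1. In AP(g, k) every
-- distance |d g|ₙ with d ≥ 1 has multiplicity at least k - d, while in the family no multiplicity reaches k.
-- Let X = ⌊s/2⌋ and 1 ≤ d₁, d₂ ≤ X. Then d₁ g₁ ≢ ±d₂ g₂ (mod n), for that distance would have
-- multiplicity at least (k₁ - d₁) + (k₂ - d₂) ≥ k; and dᵢ gᵢ ≢ 0, as the progressions have distinct terms.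
-- Hence the (X + 1)² sums a g₁ + b g₂ with 0 ≤ a, b ≤ X are distinct mod n, and s² ≤ (2X + 2)² ≤ 4n.

open import Defs
open import Data.Nat as ℕ using (ℕ; NonZero; _≥_)
open import Data.Integer as ℤ using (ℤ; +_)
open import Data.Integer.GCD using (gcd)
open import Data.List using (List; []; _∷_)
open import Data.List.Relation.Unary.Unique.Propositional using (Unique)
open import Relation.Binary.PropositionalEquality using (_≡_)

open import Data.Fin using (Fin; toℕ; fromℕ<; combine; remQuot)
open import Data.Fin.Properties using (injective⇒≤; combine-remQuot; toℕ-fromℕ<; toℕ-injective; toℕ≤pred[n])
open import Data.Integer.DivMod using (a≡a%ℕn+[a/ℕn]*n; n%ℕd<d)
open import Data.Integer.Divisibility.Signed using (_∣_; divides; ∣⇒∣ᵤ; ∣m⇒∣-m; ∣m∣n⇒∣m+n; ∣m∣n⇒∣m-n)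
open import Data.Integer.Properties as ℤP
  using (+-injective; ∣i∣≡0⇒i≡0; i-j≡0⇒i≡j; m-n≡m⊖n; ∣m⊝n∣≤m⊔n; ⊖-≥; ⊖-≤; neg-distribˡ-*; neg-involutive; pos-+; pos-*)
import Data.Integer.Tactic.RingSolver as ℤ-Solver
open import Data.List using ([_]; map; _++_; length; filter; deduplicate; applyUpTo; upTo; _∷ʳ_)
open import Data.List.Properties
  using (filter-accept; filter-reject; filter-++; map-++; map-∘; length-map; length-++; length-upTo; map-upTo; upTo-∷ʳ)
open import Data.List.Membership.Propositional using (_∈_)
open import Data.List.Membership.Propositional.Properties using (∈-map⁺; ∈-map⁻; ∈-applyUpTo⁺; ∈-upTo⁻; ∈-deduplicate⁺)
open import Data.List.Relation.Binary.Permutation.Propositional.Properties using (∈-resp-↭)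
open import Data.List.Relation.Unary.All as All using (All; []; _∷_)
open import Data.List.Relation.Unary.Any using (here; there)
open import Data.List.Relation.Unary.Unique.Propositional using (_∷_)
open import Data.List.Relation.Unary.Unique.DecPropositional.Properties ℕ._≟_ using (deduplicate-!)
open import Data.Nat
  using (zero; suc; _+_; _*_; _∸_; _⊓_; ∣_-_∣; ⌊_/2⌋; _≤_; _<_; z≤n; s≤s; z<s; _≤?_; _<?_)
open import Data.Nat.Combinatorics using (_C_; nC1≡n; nCk+nC[k+1]≡[n+1]C[k+1])
open import Data.Nat.Divisibility using (>⇒∤) renaming (_∣_ to _∣ℕ_)
open import Data.Nat.DivMod using (m*n%n≡0)
open import Data.Nat.ListAction using (sum)
open import Data.Nat.ListAction.Properties using (sum-++; sum-↭)
open import Data.Nat.Properties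
open import Algebra.Properties.CommutativeSemigroup +-commutativeSemigroup using (x∙yz≈y∙xz; interchange)
import Data.Nat.Tactic.RingSolver as ℕ-Solver
open import Data.Product using (_×_; _,_; proj₁; proj₂; uncurry)
open import Data.Sum using (_⊎_; inj₁; inj₂)
open import Function using (_∘_)
open import Function.Definitions using (Injective)
open import Relation.Nullary using (yes; no; contradiction)
open import Relation.Binary.PropositionalEquality
  using (refl; sym; trans; cong; cong₂; subst; _≢_; module ≡-Reasoning)

mult-++ : ∀ xs ys d → mult (xs ++ ys) d ≡ mult xs d + mult ys d
mult-++ xs ys d = trans (cong length (filter-++ (d ℕ.≟_) xs ys)) (length-++ (filter (d ℕ.≟_) xs))

mult-∷-≡ : ∀ {x} xs → mult (x ∷ xs) x ≡ suc (mult xs x)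
mult-∷-≡ {x} xs = cong length (filter-accept (x ℕ.≟_) refl)

mult-∷-≢ : ∀ {d x} xs → d ≢ x → mult (x ∷ xs) d ≡ mult xs d
mult-∷-≢ {d} xs d≢x = cong length (filter-reject (d ℕ.≟_) d≢x)

∈⇒0<mult : ∀ {d} xs → d ∈ xs → 0 < mult xs d
∈⇒0<mult (x ∷ xs) (here refl) = subst (0 <_) (sym (mult-∷-≡ {x} xs)) z<s
∈⇒0<mult {d} (x ∷ xs) (there d∈xs) with d ℕ.≟ x
... | yes refl = subst (0 <_) (sym (mult-∷-≡ {x} xs)) z<s
... | no d≢x   = subst (0 <_) (sym (mult-∷-≢ xs d≢x)) (∈⇒0<mult xs d∈xs)

0<mult⇒∈ : ∀ {d} xs → 0 < mult xs d → d ∈ xs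
0<mult⇒∈ {d} (x ∷ xs) 0<m with d ℕ.≟ x
... | yes d≡x = here d≡x
... | no d≢x  = there (0<mult⇒∈ xs (subst (0 <_) (mult-∷-≢ xs d≢x) 0<m))

∉⇒mult≡0 : ∀ {d} xs → All (d ≢_) xs → mult xs d ≡ 0
∉⇒mult≡0 [] [] = refl
∉⇒mult≡0 (x ∷ xs) (d≢x ∷ d∉xs) = trans (mult-∷-≢ xs d≢x) (∉⇒mult≡0 xs d∉xs)

unique⇒mult≡1 : ∀ {d} xs → Unique xs → d ∈ xs → mult xs d ≡ 1
unique⇒mult≡1 (x ∷ xs) (x∉xs ∷ _) (here refl) = trans (mult-∷-≡ {x} xs) (cong suc (∉⇒mult≡0 xs x∉xs))
unique⇒mult≡1 (x ∷ xs) (x∉xs ∷ xs!) (there d∈xs) =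
  trans (mult-∷-≢ xs λ { refl → All.lookup x∉xs d∈xs refl }) (unique⇒mult≡1 xs xs! d∈xs)

sum-mult-∷ : ∀ x xs ds → sum (map (mult (x ∷ xs)) ds) ≡ mult ds x + sum (map (mult xs) ds)
sum-mult-∷ x xs [] = refl
sum-mult-∷ x xs (d ∷ ds) with d ℕ.≟ x
... | yes refl rewrite mult-∷-≡ {x} xs | mult-∷-≡ {x} ds | sum-mult-∷ x xs ds =
  cong suc (x∙yz≈y∙xz (mult xs x) (mult ds x) _)
... | no d≢x rewrite mult-∷-≢ xs d≢x | mult-∷-≢ ds (d≢x ∘ sym) | sum-mult-∷ x xs ds =
  x∙yz≈y∙xz (mult xs d) (mult ds x) _

sum-mult≡length : ∀ xs ds → Unique ds → (∀ {x} → x ∈ xs → x ∈ ds) →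
                  sum (map (mult xs) ds) ≡ length xs
sum-mult≡length [] ds _ _ = sum-mult-[] ds
  where
  sum-mult-[] : ∀ ds → sum (map (mult []) ds) ≡ 0
  sum-mult-[] [] = refl
  sum-mult-[] (_ ∷ ds) = sum-mult-[] ds
sum-mult≡length (x ∷ xs) ds ds! xs⊆ds = begin
  sum (map (mult (x ∷ xs)) ds)       ≡⟨ sum-mult-∷ x xs ds ⟩
  mult ds x + sum (map (mult xs) ds) ≡⟨ cong₂ _+_ (unique⇒mult≡1 ds ds! (xs⊆ds (here refl)))
                                                  (sum-mult≡length xs ds ds! (xs⊆ds ∘ there)) ⟩
  suc (length xs)                    ∎
  where open ≡-Reasoning

-- Pairs and binomial coefficients

[1+n]C2 : ∀ n → suc n C 2 ≡ n + n C 2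
[1+n]C2 n = trans (sym (nCk+nC[k+1]≡[n+1]C[k+1] n 1)) (cong (_+ n C 2) (nC1≡n n))

length-pairs : ∀ {A : Set} (xs : List A) → length (pairs xs) ≡ length xs C 2
length-pairs [] = refl
length-pairs (x ∷ xs) = begin
  length (map (x ,_) xs ++ pairs xs)         ≡⟨ length-++ (map (x ,_) xs) ⟩
  length (map (x ,_) xs) + length (pairs xs) ≡⟨ cong₂ _+_ (length-map (x ,_) xs) (length-pairs xs) ⟩
  length xs + length xs C 2                  ≡⟨ sym ([1+n]C2 (length xs)) ⟩
  suc (length xs) C 2                        ∎
  where open ≡-Reasoning

sum-map-suc-upTo-∸1 : ∀ k → sum (map suc (upTo (k ∸ 1))) ≡ k C 2
sum-map-suc-upTo-∸1 zero = refl
sum-map-suc-upTo-∸1 (suc zero) = refl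
sum-map-suc-upTo-∸1 (suc (suc m)) = begin
  sum (map suc (upTo (suc m)))         ≡⟨ cong (sum ∘ map suc) (sym (upTo-∷ʳ m)) ⟩
  sum (map suc (upTo m ∷ʳ m))          ≡⟨ cong sum (map-++ suc (upTo m) [ m ]) ⟩
  sum (map suc (upTo m) ++ [ suc m ])  ≡⟨ sum-++ (map suc (upTo m)) [ suc m ] ⟩
  sum (map suc (upTo m)) + (suc m + 0) ≡⟨ cong₂ _+_ (sum-map-suc-upTo-∸1 (suc m)) (+-identityʳ (suc m)) ⟩
  suc m C 2 + suc m                    ≡⟨ +-comm (suc m C 2) (suc m) ⟩
  suc m + suc m C 2                    ≡⟨ sym ([1+n]C2 (suc m)) ⟩
  suc (suc m) C 2                      ∎
  where open ≡-Reasoning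

[m+n]C2 : ∀ m n → (m + n) C 2 ≡ m C 2 + n C 2 + m * n
[m+n]C2 zero n = sym (+-identityʳ (n C 2))
[m+n]C2 (suc m) n = begin
  suc (m + n) C 2                      ≡⟨ [1+n]C2 (m + n) ⟩
  m + n + (m + n) C 2                  ≡⟨ cong (λ c → m + n + c) ([m+n]C2 m n) ⟩
  m + n + (m C 2 + n C 2 + m * n)      ≡⟨ rearrange m n (m C 2) (n C 2) ⟩
  m + m C 2 + n C 2 + (n + m * n)      ≡⟨ cong (λ c → c + n C 2 + suc m * n) (sym ([1+n]C2 m)) ⟩
  suc m C 2 + n C 2 + suc m * n        ∎
  where
  open ≡-Reasoning
  rearrange : ∀ a b c d → a + b + (c + d + a * b) ≡ a + c + d + (b + a * b)
  rearrange = ℕ-Solver.solve-∀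

C2-mono-≤ : ∀ {m n} → m ≤ n → m C 2 ≤ n C 2
C2-mono-≤ {m} m≤n with o , refl ← m≤n⇒∃[o]m+o≡n m≤n =
  subst (m C 2 ≤_) (sym ([m+n]C2 m o)) (≤-trans (m≤m+n (m C 2) (o C 2)) (m≤m+n _ (m * o)))

C2-split⇒< : ∀ {k m n} → 0 < m → 0 < n → k C 2 ≡ m C 2 + n C 2 → k < m + n
C2-split⇒< {k} {m@(suc _)} {n@(suc _)} _ _ eq with m + n ≤? k
... | no m+n≰k = ≰⇒> m+n≰k
... | yes m+n≤k = contradiction (begin-strict
  m C 2 + n C 2         <⟨ m<m+n (m C 2 + n C 2) z<s ⟩
  m C 2 + n C 2 + m * n ≡⟨ sym ([m+n]C2 m n) ⟩
  (m + n) C 2           ≤⟨ C2-mono-≤ m+n≤k ⟩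
  k C 2                 ≡⟨ eq ⟩
  m C 2 + n C 2         ∎) (<-irrefl refl)
  where open ≤-Reasoning

deep⇒mult< : ∀ {L k} → HasDeepMultiplicities L k → ∀ {v} → 0 < mult L v → mult L v < k
deep⇒mult< {L} {k} deep 0<mult
  with x , x∈upTo , mult≡1+x ← ∈-map⁻ suc (∈-resp-↭ deep (∈-map⁺ (mult L)
         (∈-deduplicate⁺ ℕ._≟_ (0<mult⇒∈ L 0<mult))))
  = subst (_< k) (sym mult≡1+x) (<∸1⇒1+< (∈-upTo⁻ x∈upTo))
  where
  <∸1⇒1+< : ∀ {x m} → x < m ∸ 1 → suc x < m
  <∸1⇒1+< {m = zero} ()
  <∸1⇒1+< {m = suc m} x<m = s≤s x<m

deep⇒length : ∀ {L k} → HasDeepMultiplicities L k → length L ≡ k C 2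
deep⇒length {L} {k} deep = begin
  length L                      ≡⟨ sum-mult≡length L dL (deduplicate-! L) (∈-deduplicate⁺ ℕ._≟_) ⟨
  sum (map (mult L) dL)         ≡⟨ sum-↭ deep ⟩
  sum (map suc (upTo (k ∸ 1)))  ≡⟨ sum-map-suc-upTo-∸1 k ⟩
  k C 2                         ∎
  where
  open ≡-Reasoning
  dL : List ℕ
  dL = deduplicate ℕ._≟_ L

map-pairs-∷ : ∀ {A : Set} (δ : A → A → ℕ) x xs →
              map (uncurry δ) (pairs (x ∷ xs)) ≡ map (δ x) xs ++ map (uncurry δ) (pairs xs)
map-pairs-∷ δ x xs = trans (map-++ (uncurry δ) (map (x ,_) xs) (pairs xs))
                           (cong (_++ map (uncurry δ) (pairs xs)) (sym (map-∘ xs)))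

∸≤mult-pairs : ∀ {A : Set} (δ : A → A → ℕ) (f : ℕ → A) {d w} →
               (∀ i → δ (f i) (f (i + suc d)) ≡ w) →
               ∀ k → k ∸ suc d ≤ mult (map (uncurry δ) (pairs (applyUpTo f k))) w
∸≤mult-pairs δ f gap zero = z≤n
∸≤mult-pairs δ f {d} {w} gap (suc k) with d <? k
... | no d≮k rewrite m≤n⇒m∸n≡0 (≮⇒≥ d≮k) = z≤n
... | yes d<k = begin
  k ∸ d                                                  ≡⟨ +-∸-assoc 1 d<k ⟩
  1 + (k ∸ suc d)                                        ≤⟨ +-mono-≤ first-row later-rows ⟩
  mult (map (δ (f 0)) rest) w + mult (map (uncurry δ) (pairs rest)) w
                                                         ≡⟨ mult-++ (map (δ (f 0)) rest) _ w ⟨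
  mult (map (δ (f 0)) rest ++ map (uncurry δ) (pairs rest)) w
                                                         ≡⟨ cong (λ ps → mult ps w) (map-pairs-∷ δ (f 0) rest) ⟨
  mult (map (uncurry δ) (pairs (f 0 ∷ rest))) w          ∎
  where
  open ≤-Reasoning
  rest : List _
  rest = applyUpTo (f ∘ suc) k
  first-row : 1 ≤ mult (map (δ (f 0)) rest) w
  first-row = ∈⇒0<mult (map (δ (f 0)) rest)
                (subst (_∈ map (δ (f 0)) rest) (gap 0) (∈-map⁺ (δ (f 0)) (∈-applyUpTo⁺ (f ∘ suc) d<k)))
  later-rows : k ∸ suc d ≤ mult (map (uncurry δ) (pairs rest)) w
  later-rows = ∸≤mult-pairs δ (f ∘ suc) (gap ∘ suc) k

Unique-applyUpTo⇒≢ : ∀ {A : Set} (f : ℕ → A) {i j k} →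
                     Unique (applyUpTo f k) → i < j → j < k → f i ≢ f j
Unique-applyUpTo⇒≢ f {zero} {suc j} {suc k} (f0∉ ∷ _) _ (s≤s j<k) =
  All.lookup f0∉ (∈-applyUpTo⁺ (f ∘ suc) j<k)
Unique-applyUpTo⇒≢ f {suc i} {suc j} {suc k} (_ ∷ fs!) (s≤s i<j) (s≤s j<k) =
  Unique-applyUpTo⇒≢ (f ∘ suc) fs! i<j j<k

-- Congruences modulo n

-- A record rather than a synonym for + n ∣ x - y, so that x and y can be inferred.
infix 4 _≡_mod_
record _≡_mod_ (x y : ℤ) (n : ℕ) : Set where
  constructor ∣⇒≡mod
  field ≡mod⇒∣ : + n ∣ x ℤ.- y

module _ {n : ℕ} where

  ≡mod-sym : ∀ {x y} → x ≡ y mod n → y ≡ x mod n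
  ≡mod-sym {x} {y} (∣⇒≡mod x≡y) = ∣⇒≡mod (subst (+ n ∣_) (flip x y) (∣m⇒∣-m x≡y))
    where
    flip : ∀ x y → ℤ.- (x ℤ.- y) ≡ y ℤ.- x
    flip = ℤ-Solver.solve-∀

  ≡mod-trans : ∀ {x y z} → x ≡ y mod n → y ≡ z mod n → x ≡ z mod n
  ≡mod-trans {x} {y} {z} (∣⇒≡mod x≡y) (∣⇒≡mod y≡z) =
    ∣⇒≡mod (subst (+ n ∣_) (telescope x y z) (∣m∣n⇒∣m+n x≡y y≡z))
    where
    telescope : ∀ x y z → (x ℤ.- y) ℤ.+ (y ℤ.- z) ≡ x ℤ.- z
    telescope = ℤ-Solver.solve-∀

  ≡mod-neg : ∀ {x y} → x ≡ y mod n → ℤ.- x ≡ ℤ.- y mod n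
  ≡mod-neg {x} {y} (∣⇒≡mod x≡y) = ∣⇒≡mod (subst (+ n ∣_) (negate x y) (∣m⇒∣-m x≡y))
    where
    negate : ∀ x y → ℤ.- (x ℤ.- y) ≡ ℤ.- x ℤ.- ℤ.- y
    negate = ℤ-Solver.solve-∀

  ≡mod-sub : ∀ {x x′ y y′} → x ≡ x′ mod n → y ≡ y′ mod n → x ℤ.- y ≡ x′ ℤ.- y′ mod n
  ≡mod-sub {x} {x′} {y} {y′} (∣⇒≡mod x≡x′) (∣⇒≡mod y≡y′) =
    ∣⇒≡mod (subst (+ n ∣_) (regroup x x′ y y′) (∣m∣n⇒∣m-n x≡x′ y≡y′))
    where
    regroup : ∀ x x′ y y′ → (x ℤ.- x′) ℤ.- (y ℤ.- y′) ≡ (x ℤ.- y) ℤ.- (x′ ℤ.- y′)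
    regroup = ℤ-Solver.solve-∀

module _ (n : ℕ) .{{_ : NonZero n}} where

  ≡res : ∀ x → x ≡ + res n x mod n
  ≡res x = ∣⇒≡mod (divides (x ℤ./ℕ n) (begin
    x ℤ.- + r                        ≡⟨ cong (ℤ._- + r) (a≡a%ℕn+[a/ℕn]*n x n) ⟩
    (+ r ℤ.+ q ℤ.* + n) ℤ.- + r      ≡⟨ cancel (+ r) q (+ n) ⟩
    q ℤ.* + n                        ∎))
    where
    open ≡-Reasoning
    r : ℕ
    r = res n x
    q : ℤ
    q = x ℤ./ℕ n
    cancel : ∀ r q n → (r ℤ.+ q ℤ.* n) ℤ.- r ≡ q ℤ.* n
    cancel = ℤ-Solver.solve-∀

  residue-unique : ∀ {r r′} → r < n → r′ < n → + r ≡ + r′ mod n → r ≡ r′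
  residue-unique {r} {r′} r<n r′<n (∣⇒≡mod n∣r-r′) =
    +-injective (i-j≡0⇒i≡j (+ r) (+ r′) (∣i∣≡0⇒i≡0 (small-multiple≡0 ∣r-r′∣<n (∣⇒∣ᵤ n∣r-r′))))
    where
    ∣r-r′∣<n : ℤ.∣ + r ℤ.- + r′ ∣ < n
    ∣r-r′∣<n = subst (_< n) (cong ℤ.∣_∣ (sym (m-n≡m⊖n r r′)))
                     (≤-<-trans (∣m⊝n∣≤m⊔n r r′) (⊔-lub r<n r′<n))
    small-multiple≡0 : ∀ {m} → m < n → n ∣ℕ m → m ≡ 0
    small-multiple≡0 {zero} _ _ = refl
    small-multiple≡0 {suc m} m<n n∣m = contradiction n∣m (>⇒∤ m<n)

  res-cong : ∀ {x y} → x ≡ y mod n → res n x ≡ res n y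
  res-cong {x} {y} x≡y = residue-unique (n%ℕd<d x n) (n%ℕd<d y n)
    (≡mod-trans (≡mod-sym (≡res x)) (≡mod-trans x≡y (≡res y)))

  res-injective : ∀ {x y} → res n x ≡ res n y → x ≡ y mod n
  res-injective {x} {y} rx≡ry =
    ≡mod-trans (≡res x) (subst (λ r → + r ≡ y mod n) (sym rx≡ry) (≡mod-sym (≡res y)))

  absn-cong : ∀ {x y} → x ≡ y mod n → absn n x ≡ absn n y
  absn-cong x≡y = cong₂ _⊓_ (res-cong x≡y) (res-cong (≡mod-neg x≡y))

  absn-neg : ∀ x → absn n (ℤ.- x) ≡ absn n x
  absn-neg x = trans (cong (λ y → res n (ℤ.- x) ⊓ res n y) (neg-involutive x))
                     (⊓-comm (res n (ℤ.- x)) (res n x))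

  res-0 : res n (+ 0) ≡ 0
  res-0 = m*n%n≡0 0 n

  absn-0 : absn n (+ 0) ≡ 0
  absn-0 = cong₂ _⊓_ res-0 res-0

  absn≡0⇒≡0 : ∀ x → absn n x ≡ 0 → x ≡ + 0 mod n
  absn≡0⇒≡0 x absn≡0 with ⊓-sel (res n x) (res n (ℤ.- x))
  ... | inj₁ absn≡res  = res-injective (trans (sym absn≡res) (trans absn≡0 (sym res-0)))
  ... | inj₂ absn≡res- = subst (λ y → y ≡ + 0 mod n) (neg-involutive x) (≡mod-neg {y = + 0}
                           (res-injective {ℤ.- x} (trans (sym absn≡res-) (trans absn≡0 (sym res-0)))))

  dist-res : ∀ x y → dist n (res n x) (res n y) ≡ absn n (x ℤ.- y)
  dist-res x y = absn-cong (≡mod-sub (≡mod-sym (≡res x)) (≡mod-sym (≡res y)))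

+m-+n≡±∣m-n∣ : ∀ m n → (+ m ℤ.- + n ≡ + ∣ m - n ∣) ⊎ (+ m ℤ.- + n ≡ ℤ.- + ∣ m - n ∣)
+m-+n≡±∣m-n∣ m n with ≤-total n m
... | inj₁ n≤m = inj₁ (trans (m-n≡m⊖n m n) (trans (⊖-≥ n≤m) (cong +_ (sym (m≤n⇒∣n-m∣≡n∸m n≤m)))))
... | inj₂ m≤n = inj₂ (trans (m-n≡m⊖n m n) (trans (⊖-≤ m≤n) (cong (ℤ.-_ ∘ +_) (sym (m≤n⇒∣m-n∣≡n∸m m≤n)))))

absn-*-gap : ∀ n .{{_ : NonZero n}} a a′ g → absn n ((+ a ℤ.- + a′) ℤ.* g) ≡ absn n (+ ∣ a - a′ ∣ ℤ.* g)
absn-*-gap n a a′ g with +m-+n≡±∣m-n∣ a a′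
... | inj₁ a-a′≡d  = cong (λ i → absn n (i ℤ.* g)) a-a′≡d
... | inj₂ a-a′≡-d = begin
  absn n ((+ a ℤ.- + a′) ℤ.* g)    ≡⟨ cong (λ i → absn n (i ℤ.* g)) a-a′≡-d ⟩
  absn n (ℤ.- + d ℤ.* g)           ≡⟨ cong (absn n) (neg-distribˡ-* (+ d) g) ⟨
  absn n (ℤ.- (+ d ℤ.* g))         ≡⟨ absn-neg n (+ d ℤ.* g) ⟩
  absn n (+ d ℤ.* g)               ∎
  where
  open ≡-Reasoning
  d : ℕ
  d = ∣ a - a′ ∣

module _ (n : ℕ) .{{_ : NonZero n}} (g : ℤ) where

  term : ℕ → ℕ
  term i = res n (+ i ℤ.* g)

  AP≡applyUpTo : ∀ k → AP n g k ≡ applyUpTo term k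
  AP≡applyUpTo = map-upTo term

  length-Δ-AP : ∀ k → length (Δ n (AP n g k)) ≡ k C 2
  length-Δ-AP k = begin
    length (Δ n (AP n g k))     ≡⟨ length-map (uncurry (dist n)) (pairs (AP n g k)) ⟩
    length (pairs (AP n g k))   ≡⟨ length-pairs (AP n g k) ⟩
    length (AP n g k) C 2       ≡⟨ cong (_C 2) (trans (length-map term (upTo k)) (length-upTo k)) ⟩
    k C 2                       ∎
    where open ≡-Reasoning

  dist-term : ∀ d i → dist n (term i) (term (i + d)) ≡ absn n (+ d ℤ.* g)
  dist-term d i = begin
    dist n (term i) (term (i + d))             ≡⟨ dist-res n (+ i ℤ.* g) (+ (i + d) ℤ.* g) ⟩
    absn n (+ i ℤ.* g ℤ.- + (i + d) ℤ.* g)     ≡⟨ cong (λ j → absn n (+ i ℤ.* g ℤ.- j ℤ.* g)) (pos-+ i d) ⟩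
    absn n (+ i ℤ.* g ℤ.- (+ i ℤ.+ + d) ℤ.* g) ≡⟨ cong (absn n) (step-back (+ i) (+ d) g) ⟩
    absn n (ℤ.- (+ d ℤ.* g))                   ≡⟨ absn-neg n (+ d ℤ.* g) ⟩
    absn n (+ d ℤ.* g)                         ∎
    where
    open ≡-Reasoning
    step-back : ∀ i d g → i ℤ.* g ℤ.- (i ℤ.+ d) ℤ.* g ≡ ℤ.- (d ℤ.* g)
    step-back = ℤ-Solver.solve-∀

  ∸≤mult-Δ-AP : ∀ d k → k ∸ suc d ≤ mult (Δ n (AP n g k)) (absn n (+ suc d ℤ.* g))
  ∸≤mult-Δ-AP d k rewrite AP≡applyUpTo k = ∸≤mult-pairs (dist n) term (dist-term (suc d)) k

  Unique-AP⇒absn≢0 : ∀ {d k} → Unique (AP n g k) → 0 < d → d < k → absn n (+ d ℤ.* g) ≢ 0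
  Unique-AP⇒absn≢0 {d} {k} AP! 0<d d<k absn≡0 =
    Unique-applyUpTo⇒≢ term (subst Unique (AP≡applyUpTo k) AP!) 0<d d<k
      (sym (res-cong n (absn≡0⇒≡0 n (+ d ℤ.* g) absn≡0)))

square≤ : ∀ {m n} (f : Fin m × Fin m → Fin n) → Injective _≡_ _≡_ f → m * m ≤ n
square≤ {m} f f-injective = injective⇒≤ {f = f ∘ remQuot {m} m} λ {i} {j} fi≡fj → begin
  i                                    ≡⟨ combine-remQuot {m} m i ⟨
  uncurry combine (remQuot {m} m i)    ≡⟨ cong (uncurry combine) (f-injective fi≡fj) ⟩
  uncurry combine (remQuot {m} m j)    ≡⟨ combine-remQuot {m} m j ⟩
  j                                    ∎
  where open ≡-Reasoning

≤∸+∸ : ∀ {k s a b d e} → a + b ≡ k + s → d + e ≤ s → d ≤ a → e ≤ b → k ≤ (a ∸ d) + (b ∸ e)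
≤∸+∸ {k} {s} {a} {b} {d} {e} a+b≡k+s d+e≤s d≤a e≤b = +-cancelʳ-≤ (d + e) k _ (begin
  k + (d + e)               ≤⟨ +-monoʳ-≤ k d+e≤s ⟩
  k + s                     ≡⟨ a+b≡k+s ⟨
  a + b                     ≡⟨ cong₂ _+_ (m∸n+n≡m d≤a) (m∸n+n≡m e≤b) ⟨
  (a ∸ d + d) + (b ∸ e + e) ≡⟨ interchange (a ∸ d) d (b ∸ e) e ⟩
  (a ∸ d + (b ∸ e)) + (d + e) ∎)
  where open ≤-Reasoning

-- Two progressions forming an Erdős-deep family

module DeepPair
  (n : ℕ) .{{_ : NonZero n}} (g₁ g₂ : ℤ) (k₁ k₂ k : ℕ)
  (k₂≤k₁ : k₁ ≥ k₂) (3≤k₂ : k₂ ≥ 3)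
  (AP₁! : Unique (AP n g₁ k₁)) (AP₂! : Unique (AP n g₂ k₂))
  (deep : ErdosDeepWith n (AP n g₁ k₁ ∷ AP n g₂ k₂ ∷ []) k)
  where

  Δ₁ Δ₂ : List ℕ
  Δ₁ = Δ n (AP n g₁ k₁)
  Δ₂ = Δ n (AP n g₂ k₂)

  mult-ΔF : ∀ v → mult (ΔF n (AP n g₁ k₁ ∷ AP n g₂ k₂ ∷ [])) v ≡ mult Δ₁ v + mult Δ₂ v
  mult-ΔF v = trans (mult-++ Δ₁ (Δ₂ ++ []) v)
                    (cong (_+_ (mult Δ₁ v)) (trans (mult-++ Δ₂ [] v) (+-identityʳ (mult Δ₂ v))))

  mult<k : ∀ {v} → 0 < mult Δ₁ v + mult Δ₂ v → mult Δ₁ v + mult Δ₂ v < k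
  mult<k {v} 0<m =
    subst (_< k) (mult-ΔF v) (deep⇒mult< {k = k} deep (subst (0 <_) (sym (mult-ΔF v)) 0<m))

  kC2≡k₁C2+k₂C2 : k C 2 ≡ k₁ C 2 + k₂ C 2
  kC2≡k₁C2+k₂C2 = begin
    k C 2                          ≡⟨ deep⇒length {k = k} deep ⟨
    length (Δ₁ ++ Δ₂ ++ [])        ≡⟨ length-++ Δ₁ ⟩
    length Δ₁ + length (Δ₂ ++ [])  ≡⟨ cong (_+_ (length Δ₁)) (trans (length-++ Δ₂) (+-identityʳ _)) ⟩
    length Δ₁ + length Δ₂          ≡⟨ cong₂ _+_ (length-Δ-AP n g₁ k₁) (length-Δ-AP n g₂ k₂) ⟩
    k₁ C 2 + k₂ C 2                ∎
    where open ≡-Reasoning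

  3≤k₁ : 3 ≤ k₁
  3≤k₁ = ≤-trans 3≤k₂ k₂≤k₁

  k<k₁+k₂ : k < k₁ + k₂
  k<k₁+k₂ = C2-split⇒< (≤-trans z<s 3≤k₁) (≤-trans z<s 3≤k₂) kC2≡k₁C2+k₂C2

  k₁≤k : k₁ ≤ k
  k₁≤k = ≤-trans (m≤n+m∸n k₁ 1) (≤-<-trans k₁∸1≤mult (mult<k (<-≤-trans 0<k₁∸1 k₁∸1≤mult)))
    where
    k₁∸1≤mult : k₁ ∸ 1 ≤ mult Δ₁ (absn n (+ 1 ℤ.* g₁)) + mult Δ₂ (absn n (+ 1 ℤ.* g₁))
    k₁∸1≤mult = ≤-trans (∸≤mult-Δ-AP n g₁ 0 k₁) (m≤m+n _ _)
    0<k₁∸1 : 0 < k₁ ∸ 1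
    0<k₁∸1 = <-≤-trans z<s (∸-monoˡ-≤ 1 3≤k₁)

  s : ℕ
  s = k₁ + k₂ ∸ k

  k₁+k₂≡k+s : k₁ + k₂ ≡ k + s
  k₁+k₂≡k+s = sym (m+[n∸m]≡n (<⇒≤ k<k₁+k₂))

  X : ℕ
  X = ⌊ s /2⌋

  X+X≤s : X + X ≤ s
  X+X≤s = subst (X + X ≤_) (⌊n/2⌋+⌈n/2⌉≡n s) (+-monoʳ-≤ X (⌊n/2⌋≤⌈n/2⌉ s))

  s≤2[1+X] : s ≤ suc X + suc X
  s≤2[1+X] = subst (_≤ suc X + suc X) (⌊n/2⌋+⌈n/2⌉≡n s)
                   (+-mono-≤ (n≤1+n X) (⌊n/2⌋-mono (n≤1+n (suc s))))

  X<k₂ : X < k₂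
  X<k₂ = ≤-<-trans (⌊n/2⌋-mono s≤k₂) (⌊n/2⌋<n⁺ (≤-trans z<s 3≤k₂))
    where
    s≤k₂ : s ≤ k₂
    s≤k₂ = ≤-trans (∸-monoʳ-≤ (k₁ + k₂) k₁≤k) (≤-reflexive (m+n∸m≡n k₁ k₂))
    ⌊n/2⌋<n⁺ : ∀ {m} → 0 < m → ⌊ m /2⌋ < m
    ⌊n/2⌋<n⁺ {suc m} _ = ⌊n/2⌋<n m

  X<k₁ : X < k₁
  X<k₁ = <-≤-trans X<k₂ k₂≤k₁

  gaps-vanish : ∀ {d₁ d₂} → d₁ ≤ X → d₂ ≤ X →
                absn n (+ d₁ ℤ.* g₁) ≡ absn n (+ d₂ ℤ.* g₂) → d₁ ≡ 0 × d₂ ≡ 0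
  gaps-vanish {zero} {zero} _ _ _ = refl , refl
  gaps-vanish {zero} {suc d₂} _ d₂≤X same =
    contradiction (trans (sym same) (absn-0 n)) (Unique-AP⇒absn≢0 n g₂ AP₂! z<s (≤-<-trans d₂≤X X<k₂))
  gaps-vanish {suc d₁} {zero} d₁≤X _ same =
    contradiction (trans same (absn-0 n)) (Unique-AP⇒absn≢0 n g₁ AP₁! z<s (≤-<-trans d₁≤X X<k₁))
  gaps-vanish {suc d₁} {suc d₂} d₁≤X d₂≤X same =
    contradiction too-many (<⇒≱ (mult<k (<-≤-trans 0<k too-many)))
    where
    v : ℕ
    v = absn n (+ suc d₁ ℤ.* g₁)
    0<k : 0 < k
    0<k = <-≤-trans (≤-trans z<s 3≤k₁) k₁≤k
    in-Δ₂ : k₂ ∸ suc d₂ ≤ mult Δ₂ v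
    in-Δ₂ = subst (λ w → k₂ ∸ suc d₂ ≤ mult Δ₂ w) (sym same) (∸≤mult-Δ-AP n g₂ d₂ k₂)
    too-many : k ≤ mult Δ₁ v + mult Δ₂ v
    too-many = begin
      k                               ≤⟨ ≤∸+∸ k₁+k₂≡k+s (≤-trans (+-mono-≤ d₁≤X d₂≤X) X+X≤s)
                                              (<⇒≤ (≤-<-trans d₁≤X X<k₁)) (<⇒≤ (≤-<-trans d₂≤X X<k₂)) ⟩
      (k₁ ∸ suc d₁) + (k₂ ∸ suc d₂)   ≤⟨ +-mono-≤ (∸≤mult-Δ-AP n g₁ d₁ k₁) in-Δ₂ ⟩
      mult Δ₁ v + mult Δ₂ v           ∎
      where open ≤-Reasoning

  point : ℕ → ℕ → ℤ
  point a b = + a ℤ.* g₁ ℤ.+ + b ℤ.* g₂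

  point-injective : ∀ {a b a′ b′} → a ≤ X → a′ ≤ X → b ≤ X → b′ ≤ X →
                    point a b ≡ point a′ b′ mod n → a ≡ a′ × b ≡ b′
  point-injective {a} {b} {a′} {b′} a≤X a′≤X b≤X b′≤X (∣⇒≡mod n∣Δpoint) =
    ∣m-n∣≡0⇒m≡n (proj₁ vanish) , sym (∣m-n∣≡0⇒m≡n (proj₂ vanish))
    where
    gap≤X : ∀ {x y} → x ≤ X → y ≤ X → ∣ x - y ∣ ≤ X
    gap≤X {x} {y} x≤X y≤X = ≤-trans (∣m-n∣≤m⊔n x y) (⊔-lub x≤X y≤X)
    split : ∀ a b a′ b′ g₁ g₂ → (a ℤ.* g₁ ℤ.+ b ℤ.* g₂) ℤ.- (a′ ℤ.* g₁ ℤ.+ b′ ℤ.* g₂)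
                                ≡ (a ℤ.- a′) ℤ.* g₁ ℤ.- (b′ ℤ.- b) ℤ.* g₂
    split = ℤ-Solver.solve-∀
    gap₁≡gap₂ : (+ a ℤ.- + a′) ℤ.* g₁ ≡ (+ b′ ℤ.- + b) ℤ.* g₂ mod n
    gap₁≡gap₂ = ∣⇒≡mod (subst (+ n ∣_) (split (+ a) (+ b) (+ a′) (+ b′) g₁ g₂) n∣Δpoint)
    same-absn : absn n (+ ∣ a - a′ ∣ ℤ.* g₁) ≡ absn n (+ ∣ b′ - b ∣ ℤ.* g₂)
    same-absn = begin
      absn n (+ ∣ a - a′ ∣ ℤ.* g₁)      ≡⟨ absn-*-gap n a a′ g₁ ⟨
      absn n ((+ a ℤ.- + a′) ℤ.* g₁)    ≡⟨ absn-cong n gap₁≡gap₂ ⟩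
      absn n ((+ b′ ℤ.- + b) ℤ.* g₂)    ≡⟨ absn-*-gap n b′ b g₂ ⟩
      absn n (+ ∣ b′ - b ∣ ℤ.* g₂)      ∎
      where open ≡-Reasoning
    vanish : ∣ a - a′ ∣ ≡ 0 × ∣ b′ - b ∣ ≡ 0
    vanish = gaps-vanish (gap≤X a≤X a′≤X) (gap≤X b′≤X b≤X) same-absn

  grid-point : Fin (suc X) × Fin (suc X) → Fin n
  grid-point (a , b) = fromℕ< (n%ℕd<d (point (toℕ a) (toℕ b)) n)

  grid-point-injective : Injective _≡_ _≡_ grid-point
  grid-point-injective {a , b} {a′ , b′} same-residue =
    cong₂ _,_ (toℕ-injective (proj₁ same-coordinates)) (toℕ-injective (proj₂ same-coordinates))
    where
    same-coordinates : toℕ a ≡ toℕ a′ × toℕ b ≡ toℕ b′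
    same-coordinates =
      point-injective (toℕ≤pred[n] a) (toℕ≤pred[n] a′) (toℕ≤pred[n] b) (toℕ≤pred[n] b′)
        (res-injective n (trans (sym (toℕ-fromℕ< _)) (trans (cong toℕ same-residue) (toℕ-fromℕ< _))))

  s*s≤4n : s * s ≤ 4 * n
  s*s≤4n = begin
    s * s                               ≤⟨ *-mono-≤ s≤2[1+X] s≤2[1+X] ⟩
    (suc X + suc X) * (suc X + suc X)   ≡⟨ double-square (suc X) ⟩
    4 * (suc X * suc X)                 ≤⟨ *-monoʳ-≤ 4 (square≤ grid-point grid-point-injective) ⟩
    4 * n                               ∎
    where
    open ≤-Reasoning
    double-square : ∀ y → (y + y) * (y + y) ≡ 4 * (y * y)
    double-square = ℕ-Solver.solve-∀

  k₂-[k-k₁]≡s : + k₂ ℤ.- (+ k ℤ.- + k₁) ≡ + s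
  k₂-[k-k₁]≡s = begin
    + k₂ ℤ.- (+ k ℤ.- + k₁)    ≡⟨ regroup (+ k₁) (+ k₂) (+ k) ⟩
    (+ k₁ ℤ.+ + k₂) ℤ.- + k    ≡⟨ cong (ℤ._- + k) (pos-+ k₁ k₂) ⟨
    + (k₁ + k₂) ℤ.- + k        ≡⟨ cong (λ m → + m ℤ.- + k) k₁+k₂≡k+s ⟩
    + (k + s) ℤ.- + k          ≡⟨ cong (ℤ._- + k) (pos-+ k s) ⟩
    (+ k ℤ.+ + s) ℤ.- + k      ≡⟨ cancel (+ k) (+ s) ⟩
    + s                        ∎
    where
    open ≡-Reasoning
    regroup : ∀ a b c → b ℤ.- (c ℤ.- a) ≡ (a ℤ.+ b) ℤ.- c
    regroup = ℤ-Solver.solve-∀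
    cancel : ∀ c s → (c ℤ.+ s) ℤ.- c ≡ s
    cancel = ℤ-Solver.solve-∀

proposition3p5 : (n : ℕ) .{{_ : NonZero n}} (g₁ g₂ : ℤ) (k₁ k₂ k : ℕ) →
    gcd (gcd (+ n) g₁) g₂ ≡ + 1 →
    k₁ ≥ k₂ → k₂ ≥ 3 →
    Unique (AP n g₁ k₁) → Unique (AP n g₂ k₂) →
    ErdosDeepWith n (AP n g₁ k₁ ∷ AP n g₂ k₂ ∷ []) k →
    (+ 4 ℤ.* + n) ℤ.≥ (+ k₂ ℤ.- (+ k ℤ.- + k₁)) ℤ.^ 2
proposition3p5 n g₁ g₂ k₁ k₂ k _ k₂≤k₁ 3≤k₂ AP₁! AP₂! deep = begin
  (+ k₂ ℤ.- (+ k ℤ.- + k₁)) ℤ.^ 2   ≡⟨ cong (ℤ._^ 2) k₂-[k-k₁]≡s ⟩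
  (+ s) ℤ.^ 2                       ≡⟨ cong (+ s ℤ.*_) (ℤP.*-identityʳ (+ s)) ⟩
  + s ℤ.* + s                       ≡⟨ pos-* s s ⟨
  + (s * s)                         ≤⟨ ℤ.+≤+ s*s≤4n ⟩
  + (4 * n)                         ≡⟨ pos-* 4 n ⟩
  + 4 ℤ.* + n                       ∎
  where
  open DeepPair n g₁ g₂ k₁ k₂ k k₂≤k₁ 3≤k₂ AP₁! AP₂! deep
  open ℤP.≤-Reasoning
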